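{- Let $G$ be a clean, connected graph with no induced $P_7$ and no triangle, with $V(G)=P\cup Q\cup R\cup S\cup T$ such that: $P\cup T$ is anticomplete to $R\cup S$; $S$ is anticomplete to $P\cup Q$; every vertex of $R$ has a neighbor in $Q$; there exist $q_0\in Q$ and $p_1,p_2,p_3\in P$ such that $p_1-p_2-p_3-q_0$ is an induced path; and for every $q\in Q$ there exist $p_2,p_3\in P$ and $p_1\in P\cup\{q_0\}$ such that $p_1-p_2-p_3-q$ is an induced path. Then: (1) $S$ is empty; (2) if for every $q\in Q$ there exist $p_1,p_2,p_3\in P$ such that $p_1-p_2-p_3-q$ is an induced path, then every connected component of $G[R]$ has at most two vertices; (3) every connected component of $G[R]$ is bipartite, and if some component $X$ of $G[R]$ has more than two vertices, then $q_0$ is complete to one side of the bipartition of $G[X]$.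
   Context: A vertex $u$ is dominated by $v\neq u$ if $u,v$ are non-adjacent and $N(u)\subseteq N(v)$. A vertex outside $A$ is mixed on $A$ if it has a neighbor and a non-neighbor in $A$. A non-trivial homogeneous pair of stable sets is a pair $(A,B)$ of disjoint non-empty stable sets with $2<|A|+|B|<|V(G)|$ such that no vertex outside $A\cup B$ is mixed on $A$ or on $B$. $G$ is clean if it has no dominated vertex and no non-trivial homogeneous pair of stable sets. Sets $A,B$ are anticomplete if there are no edges between them; $a$ is complete to $B$ if adjacent to all of $B$. -}

module Defs where

open import Data.Nat using (ℕ; zero; suc; _<_; _+_)
open import Data.Fin using (Fin; toℕ)
open import Data.Fin.Subset using (Subset; _∈_; _∉_; ∣_∣)
open import Data.Product using (Σ; ∃; ∃-syntax; _×_; _,_)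
open import Data.Sum using (_⊎_)
open import Data.Empty using (⊥)
open import Data.Bool using (Bool)
open import Data.Unit using (⊤)
open import Relation.Nullary using (¬_; Dec)
open import Relation.Binary.PropositionalEquality using (_≡_; _≢_)

record Graph : Set₁ where
  field
    n      : ℕ
    Adj    : Fin n → Fin n → Set
    sym    : ∀ {u v} → Adj u v → Adj v u
    irrefl : ∀ {u} → ¬ Adj u u
    dec    : ∀ u v → Dec (Adj u v)

module _ (G : Graph) where
  open Graph G

  V : Set
  V = Fin n

  Dominated : V → V → Set
  Dominated u v = u ≢ v × ¬ Adj u v × (∀ w → Adj u w → Adj v w)

  HasDominatedVertex : Set
  HasDominatedVertex = ∃[ u ] ∃[ v ] Dominated u v

  Mixed : V → Subset n → Set
  Mixed v A = v ∉ A × (∃[ a ] (a ∈ A × Adj v a)) × (∃[ a ] (a ∈ A × ¬ Adj v a))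

  Stable : Subset n → Set
  Stable A = ∀ a b → a ∈ A → b ∈ A → ¬ Adj a b

  NonTrivialHomPairStable : Subset n → Subset n → Set
  NonTrivialHomPairStable A B =
    (∀ x → x ∈ A → x ∈ B → ⊥) ×
    (∃[ a ] a ∈ A) × (∃[ b ] b ∈ B) ×
    Stable A × Stable B ×
    2 < ∣ A ∣ + ∣ B ∣ × ∣ A ∣ + ∣ B ∣ < n ×
    (∀ v → v ∉ A → v ∉ B → ¬ Mixed v A × ¬ Mixed v B)

  Clean : Set
  Clean = ¬ HasDominatedVertex × ¬ (∃[ A ] ∃[ B ] NonTrivialHomPairStable A B)

  IsInducedPath : ∀ {k} → (Fin k → V) → Set
  IsInducedPath {k} f =
    (∀ i j → f i ≡ f j → i ≡ j) ×
    (∀ i j → Adj (f i) (f j) → (toℕ i ≡ suc (toℕ j) ⊎ toℕ j ≡ suc (toℕ i))) ×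
    (∀ i j → toℕ j ≡ suc (toℕ i) → Adj (f i) (f j))

  P7Free : Set
  P7Free = ¬ (Σ (Fin 7 → V) IsInducedPath)

  TriangleFree : Set
  TriangleFree = ∀ a b c → Adj a b → Adj b c → Adj a c → ⊥

  data ReachIn (X : V → Set) : V → V → Set where
    here : ∀ {u} → X u → ReachIn X u u
    step : ∀ {u v w} → X u → Adj u v → ReachIn X v w → ReachIn X u w

  Connected : Set
  Connected = ∀ u v → ReachIn (λ _ → ⊤) u v

  IsComponentOf : (Y : V → Set) → Subset n → Set
  IsComponentOf Y X =
    (∃[ x ] x ∈ X) ×
    (∀ x → x ∈ X → Y x) ×
    (∀ x y → x ∈ X → y ∈ X → ReachIn (λ z → z ∈ X) x y) ×
    (∀ x y → x ∈ X → Y y → Adj x y → y ∈ X)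

  ProperTwoColouring : Subset n → (V → Bool) → Set
  ProperTwoColouring X c = ∀ x y → x ∈ X → y ∈ X → Adj x y → c x ≢ c y

  Bipartite : Subset n → Set
  Bipartite X = ∃[ c ] ProperTwoColouring X c

  CompleteTo : V → (V → Set) → Set
  CompleteTo v Z = ∀ z → Z z → Adj v z

data Part : Set where
  P Q R S T : Part

-- Prefixing an induced path u–w–z of G[R ∪ S], of which only z sees q, to an induced path
-- p₁–p₂–p₃–q with p₁ anticomplete to {u, w, z} gives an induced P₇. An edge from S to R would
-- produce such a path, since the S-end is not dominated by a vertex of Q; hence S = ∅, G being
-- connected. For a component X of G[R] the same obstruction makes N(q) ∩ X closed under distance two
-- in G[X] for every q ending such a path with p₁ anticomplete to X, and as G is triangle-free,
-- adjacency to q is then a proper 2-colouring of G[X]. If q₀ sees X this colouring proves (3).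
-- Otherwise, and under the hypothesis of (2), every vertex of Q seeing X colours it this way; two
-- proper 2-colourings of a connected graph agree or are complementary, so the colour classes form a
-- homogeneous pair of stable sets, which cleanness only allows when |X| ≤ 2.

module Submission where

open import Defs
open import Data.Nat using (ℕ; suc; _≤_; _<_; _+_; _<?_; z<s; s<s)
open import Data.Nat.Properties
  using (+-suc; <⇒≱; <-irrefl; <-asym; <-trans; <-≤-trans; n<1+n; suc-injective; ≮⇒≥)
open import Data.Fin using (Fin; toℕ; _≟_; #_) renaming (zero to fzero; suc to fsuc)
open import Data.Fin.Subset using (Subset; _∈_; _∉_; ∣_∣; ⁅_⁆; _∩_; ∁; Nonempty; inside; outside)
open import Data.Fin.Subset.Properties
  using (_∈?_; ∈⊤; ∣⊤∣≡n; p⊂q⇒∣p∣<∣q∣; p⊆q⇒∣p∣≤∣q∣; ∣⁅x⁆∣≡1; x∈⁅x⁆; x∈p∩q⁺; x∈p∩q⁻;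
         x∈∁p⇒x∉p; x∉p⇒x∈∁p; nonempty?; Empty-unique; ∣⊥∣≡0)
open import Data.Fin.Properties using (¬∀⟶∃¬; any?)
open import Data.Vec using (Vec; lookup; tabulate; _∷_; [])
open import Data.Vec.Properties using (lookup∘tabulate; []=⇒lookup; lookup⇒[]=)
open import Data.Vec.Relation.Unary.All using (All; _∷_; [])
open import Data.Vec.Relation.Unary.All.Properties using (lookup⁺)
open import Data.Product using (∃; ∃-syntax; _×_; _,_; proj₁; proj₂)
open import Data.Sum using (_⊎_; inj₁; inj₂)
import Data.Sum as Sum
open import Data.Bool using (Bool; true; false; not; _xor_)
open import Data.Bool.Properties using (¬-not; xor-annihilates-not; not-injective)
open import Data.Empty using (⊥; ⊥-elim)
open import Relation.Nullary using (¬_; Dec; yes; no; does; contradiction)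
open import Relation.Nullary.Decidable using (dec-true; _→-dec_; _×-dec_)
open import Relation.Unary using (Decidable)
open import Function using (case_of_; _∘_)
open import Relation.Binary.PropositionalEquality
  using (_≡_; _≢_; refl; sym; trans; cong; cong₂; subst; module ≡-Reasoning)

private variable
  m : ℕ
  p : Subset m
  f : Fin m → Bool
  x : Fin m

∣p∩q∣+∣p∩∁q∣≡∣p∣ : ∀ (p q : Subset m) → ∣ p ∩ q ∣ + ∣ p ∩ ∁ q ∣ ≡ ∣ p ∣
∣p∩q∣+∣p∩∁q∣≡∣p∣ []            []            = refl
∣p∩q∣+∣p∩∁q∣≡∣p∣ (outside ∷ p) (_       ∷ q) = ∣p∩q∣+∣p∩∁q∣≡∣p∣ p q
∣p∩q∣+∣p∩∁q∣≡∣p∣ (inside  ∷ p) (inside  ∷ q) = cong suc (∣p∩q∣+∣p∩∁q∣≡∣p∣ p q)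
∣p∩q∣+∣p∩∁q∣≡∣p∣ (inside  ∷ p) (outside ∷ q) =
  trans (+-suc ∣ p ∩ q ∣ ∣ p ∩ ∁ q ∣) (cong suc (∣p∩q∣+∣p∩∁q∣≡∣p∣ p q))

x∈tabulate⁺ : f x ≡ true → x ∈ tabulate f
x∈tabulate⁺ {f = f} {x = x} fx = lookup⇒[]= x (tabulate f) (trans (lookup∘tabulate f x) fx)

x∈tabulate⁻ : x ∈ tabulate f → f x ≡ true
x∈tabulate⁻ {f = f} x∈ = trans (sym (lookup∘tabulate f _)) ([]=⇒lookup x∈)

x∈p∩tabulate⁺ : x ∈ p → f x ≡ true → x ∈ p ∩ tabulate f
x∈p∩tabulate⁺ x∈p fx = x∈p∩q⁺ (x∈p , x∈tabulate⁺ fx)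

x∈p∩tabulate⁻ : x ∈ p ∩ tabulate f → x ∈ p × f x ≡ true
x∈p∩tabulate⁻ {p = p} x∈ with x∈p∩q⁻ p _ x∈
... | x∈p , x∈f = x∈p , x∈tabulate⁻ x∈f

x∈p∩∁tabulate⁺ : x ∈ p → f x ≡ false → x ∈ p ∩ ∁ (tabulate f)
x∈p∩∁tabulate⁺ x∈p fx = x∈p∩q⁺ (x∈p , x∉p⇒x∈∁p (λ x∈f → case trans (sym fx) (x∈tabulate⁻ x∈f) of λ ()))

x∈p∩∁tabulate⁻ : x ∈ p ∩ ∁ (tabulate f) → x ∈ p × f x ≡ false
x∈p∩∁tabulate⁻ {p = p} x∈ with x∈p∩q⁻ p _ x∈
... | x∈p , x∈∁f = x∈p , ¬-not (λ fx → x∈∁p⇒x∉p x∈∁f (x∈tabulate⁺ fx))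

x∈p⇒x∈p∩tabulate⊎x∈p∩∁tabulate : ∀ (f : Fin m → Bool) → x ∈ p → x ∈ p ∩ tabulate f ⊎ x ∈ p ∩ ∁ (tabulate f)
x∈p⇒x∈p∩tabulate⊎x∈p∩∁tabulate {x = x} f x∈p with f x in fx
... | true  = inj₁ (x∈p∩tabulate⁺ x∈p fx)
... | false = inj₂ (x∈p∩∁tabulate⁺ x∈p fx)

∣p∣>0⇒Nonempty : ∀ (p : Subset m) → 0 < ∣ p ∣ → Nonempty p
∣p∣>0⇒Nonempty {m} p ∣p∣>0 with nonempty? p
... | yes ne  = ne
... | no  ¬ne = contradiction (subst (λ q → 0 < ∣ q ∣) (Empty-unique ¬ne) ∣p∣>0) (<-irrefl (sym (∣⊥∣≡0 m)))

xor-cancelˡ : ∀ a {b c} → a xor b ≡ a xor c → b ≡ c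
xor-cancelˡ false e = e
xor-cancelˡ true  e = not-injective e

module GraphProperties (G : Graph) where
  open Graph G renaming (sym to adj-sym)

  Apart : V G → V G → Set
  Apart u v = u ≢ v × ¬ Adj u v

  inducedPath-[_] : ∀ v → IsInducedPath G (lookup (v ∷ []))
  inducedPath-[ v ] = (λ { fzero fzero _ → refl }) , (λ { fzero fzero a → contradiction a irrefl }) ,
                      (λ { fzero fzero () })

  inducedPath-∷ : ∀ {k v w} {ws : Vec (V G) k} → Adj v w → All (Apart v) ws →
                  IsInducedPath G (lookup (w ∷ ws)) → IsInducedPath G (lookup (v ∷ w ∷ ws))
  inducedPath-∷ {v = v} {w} {ws} vw apart (inj , nonadj , adj) = inj′ , nonadj′ , adj′
    where
    path : Fin _ → V G
    path = lookup (v ∷ w ∷ ws)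

    inj′ : ∀ i j → path i ≡ path j → i ≡ j
    inj′ fzero        fzero        _ = refl
    inj′ fzero        (fsuc fzero) e = contradiction (subst (λ x → Adj x w) e vw) irrefl
    inj′ fzero        (fsuc (fsuc j)) e = contradiction e (proj₁ (lookup⁺ apart j))
    inj′ (fsuc fzero) fzero        e = contradiction (subst (λ x → Adj x w) (sym e) vw) irrefl
    inj′ (fsuc (fsuc i)) fzero     e = contradiction (sym e) (proj₁ (lookup⁺ apart i))
    inj′ (fsuc i)     (fsuc j)     e = cong fsuc (inj i j e)

    nonadj′ : ∀ i j → Adj (path i) (path j) → toℕ i ≡ suc (toℕ j) ⊎ toℕ j ≡ suc (toℕ i)
    nonadj′ fzero        fzero        a = contradiction a irrefl
    nonadj′ fzero        (fsuc fzero) _ = inj₂ refl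
    nonadj′ fzero        (fsuc (fsuc j)) a = contradiction a (proj₂ (lookup⁺ apart j))
    nonadj′ (fsuc fzero) fzero        _ = inj₁ refl
    nonadj′ (fsuc (fsuc i)) fzero     a = contradiction (adj-sym a) (proj₂ (lookup⁺ apart i))
    nonadj′ (fsuc i)     (fsuc j)     a = Sum.map (cong suc) (cong suc) (nonadj i j a)

    adj′ : ∀ i j → toℕ j ≡ suc (toℕ i) → Adj (path i) (path j)
    adj′ fzero    (fsuc fzero) _ = vw
    adj′ fzero    (fsuc (fsuc j)) ()
    adj′ (fsuc i) (fsuc j)     e = adj i j (suc-injective e)

  inducedPath-edge : ∀ {k} {f : Fin k → V G} → IsInducedPath G f →
                     ∀ i j → toℕ j ≡ suc (toℕ i) → Adj (f i) (f j)
  inducedPath-edge (_ , _ , adj) = adj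

  inducedPath-apart : ∀ {k} {f : Fin k → V G} → IsInducedPath G f →
                      ∀ i j → suc (toℕ i) < toℕ j → Apart (f i) (f j)
  inducedPath-apart (inj , nonadj , _) i j i+1<j =
    (λ e → <-irrefl (cong toℕ (inj i j e)) i<j) ,
    (λ a → Sum.[ (λ e → <-asym i<j (subst (toℕ j <_) (sym e) (n<1+n (toℕ j))))
               , (λ e → <-irrefl (sym e) i+1<j) ] (nonadj i j a))
    where
    i<j : toℕ i < toℕ j
    i<j = <-trans (n<1+n (toℕ i)) i+1<j

  ≢-by-adjacency : ∀ {q x y} → ¬ Adj q x → Adj q y → x ≢ y
  ≢-by-adjacency ¬qx qy refl = ¬qx qy

  Apart-sym : ∀ {x y} → Apart x y → Apart y x
  Apart-sym (x≢y , ¬xy) = (λ e → x≢y (sym e)) , (λ yx → ¬xy (adj-sym yx))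

  inducedP₄-reverse : ∀ {a b c d} → IsInducedPath G (lookup (a ∷ b ∷ c ∷ d ∷ [])) →
                      IsInducedPath G (lookup (d ∷ c ∷ b ∷ a ∷ []))
  inducedP₄-reverse {a} {b} {c} {d} path =
    inducedPath-∷ (adj-sym cd) (Apart-sym b⊥d ∷ Apart-sym a⊥d ∷ [])
      (inducedPath-∷ (adj-sym bc) (Apart-sym a⊥c ∷ [])
        (inducedPath-∷ (adj-sym ab) [] inducedPath-[ a ]))
    where
    ab : Adj a b
    ab = inducedPath-edge path (# 0) (# 1) refl
    bc : Adj b c
    bc = inducedPath-edge path (# 1) (# 2) refl
    cd : Adj c d
    cd = inducedPath-edge path (# 2) (# 3) refl
    a⊥c : Apart a c
    a⊥c = inducedPath-apart path (# 0) (# 2) (s<s z<s)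
    a⊥d : Apart a d
    a⊥d = inducedPath-apart path (# 0) (# 3) (s<s z<s)
    b⊥d : Apart b d
    b⊥d = inducedPath-apart path (# 1) (# 3) (s<s (s<s z<s))

  undominated-witness : ¬ HasDominatedVertex G → ∀ {u v} → u ≢ v → ¬ Adj u v → ∃[ y ] (Adj u y × ¬ Adj v y)
  undominated-witness undominated {u} {v} u≢v u≁v
    with ¬∀⟶∃¬ n (λ y → Adj u y → Adj v y) (λ y → dec u y →-dec dec v y)
                 (λ N[u]⊆N[v] → undominated (u , v , u≢v , u≁v , N[u]⊆N[v]))
  ... | y , ¬[uy⇒vy] with dec u y
  ...   | yes uy = y , uy , λ vy → ¬[uy⇒vy] (λ _ → vy)
  ...   | no ¬uy = contradiction (λ uy → contradiction uy ¬uy) ¬[uy⇒vy]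

  reach-source : ∀ {Y u v} → ReachIn G Y u v → Y u
  reach-source (here Yu)     = Yu
  reach-source (step Yu _ _) = Yu

  reach-exit : ∀ {Y} {D : V G → Set} → Decidable D → ∀ {u v} → ReachIn G Y u v → D u → ¬ D v →
               ∃[ s ] ∃[ r ] (D s × ¬ D r × Adj s r)
  reach-exit D? (here _) Du ¬Dv = contradiction Du ¬Dv
  reach-exit D? (step {v = w} _ uw rest) Du ¬Dv with D? w
  ... | yes Dw = reach-exit D? rest Dw ¬Dv
  ... | no ¬Dw = _ , w , Du , ¬Dw , uw

  ConnectedSet : Subset n → Set
  ConnectedSet X = ∀ x y → x ∈ X → y ∈ X → ReachIn G (_∈ X) x y

  connectedSet-edge : ∀ {X} → ConnectedSet X → 1 < ∣ X ∣ → ∃[ x ] ∃[ y ] (x ∈ X × y ∈ X × Adj x y)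
  connectedSet-edge {X} connected 1<∣X∣ with ∣p∣>0⇒Nonempty X (<-trans z<s 1<∣X∣)
  ... | x , x∈X with ¬∀⟶∃¬ n (λ y → y ∈ X → y ≡ x) (λ y → y ∈? X →-dec y ≟ x) X≢⁅x⁆
    where
    X≢⁅x⁆ : ¬ (∀ y → y ∈ X → y ≡ x)
    X≢⁅x⁆ X⊆x = <-irrefl refl (<-≤-trans 1<∣X∣ (subst (∣ X ∣ ≤_) (∣⁅x⁆∣≡1 x)
                  (p⊆q⇒∣p∣≤∣q∣ (λ {y} y∈X → subst (_∈ ⁅ x ⁆) (sym (X⊆x y y∈X)) (x∈⁅x⁆ x)))))
  ... | y , ¬[y∈X⇒y≡x] with y ∈? X
  ...   | no y∉X = contradiction (λ y∈X → contradiction y∈X y∉X) ¬[y∈X⇒y≡x]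
  ...   | yes y∈X with connected x y x∈X y∈X
  ...     | here _ = contradiction (λ _ → refl) ¬[y∈X⇒y≡x]
  ...     | step {v = w} _ xw rest = x , w , x∈X , reach-source rest , xw

  adjTo : V G → V G → Bool
  adjTo q v = does (dec q v)

  adjTo⁺ : ∀ {q v} → Adj q v → adjTo q v ≡ true
  adjTo⁺ {q} {v} = dec-true (dec q v)

  adjTo⁻ : ∀ {q v} → adjTo q v ≡ true → Adj q v
  adjTo⁻ {q} {v} e with dec q v
  ... | yes qv = qv

  CoversEdges : V G → Subset n → Set
  CoversEdges q X = ∀ x y → x ∈ X → y ∈ X → Adj x y → Adj q x ⊎ Adj q y

  covers⇒proper : TriangleFree G → ∀ {q X} → CoversEdges q X → ProperTwoColouring G X (adjTo q)
  covers⇒proper triangleFree {q} covers x y x∈X y∈X xy with dec q x | dec q y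
  ... | yes qx | yes qy = ⊥-elim (triangleFree q x y qx xy qy)
  ... | yes _  | no _   = λ ()
  ... | no _   | yes _  = λ ()
  ... | no ¬qx | no ¬qy = ⊥-elim (Sum.[ ¬qx , ¬qy ] (covers x y x∈X y∈X xy))

  Dist2Closed : V G → Subset n → Set
  Dist2Closed q X = ∀ {u w z} → u ∈ X → w ∈ X → z ∈ X → Adj u w → Adj w z → u ≢ z → Adj q z → Adj q u

  dist2Closed-near : ∀ {q X x₀} → Dist2Closed q X → Adj q x₀ → ∀ {x} → ReachIn G (_∈ X) x x₀ →
                     Adj q x ⊎ ∃[ z ] (z ∈ X × Adj x z × Adj q z)
  dist2Closed-near closed qx₀ (here _) = inj₁ qx₀
  dist2Closed-near closed qx₀ (step {u = x} {v = w} x∈X xw rest) with dist2Closed-near closed qx₀ rest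
  ... | inj₁ qw = inj₂ (w , reach-source rest , xw , qw)
  ... | inj₂ (z , z∈X , wz , qz) with z ≟ x
  ...   | yes refl = inj₁ qz
  ...   | no z≢x   = inj₁ (closed x∈X (reach-source rest) z∈X xw wz (λ e → z≢x (sym e)) qz)

  dist2Closed⇒covers : ∀ {q X x₀} → Dist2Closed q X → ConnectedSet X → x₀ ∈ X → Adj q x₀ → CoversEdges q X
  dist2Closed⇒covers closed connected x₀∈X qx₀ x y x∈X y∈X xy
    with dist2Closed-near closed qx₀ (connected x _ x∈X x₀∈X)
  ... | inj₁ qx = inj₁ qx
  ... | inj₂ (z , z∈X , xz , qz) with z ≟ y
  ...   | yes refl = inj₂ qz
  ...   | no z≢y   = inj₂ (closed y∈X x∈X z∈X (adj-sym xy) xz (λ e → z≢y (sym e)) qz)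

  NeighboursSplit : Subset n → Set
  NeighboursSplit X = ∀ v x → v ∉ X → x ∈ X → Adj v x → ProperTwoColouring G X (adjTo v)

  module _ {X : Subset n} (connected : ConnectedSet X) where

    proper-xor-invariant : ∀ {c c′} → ProperTwoColouring G X c → ProperTwoColouring G X c′ →
                           ∀ {x y} → ReachIn G (_∈ X) x y → c x xor c′ x ≡ c y xor c′ y
    proper-xor-invariant c-proper c′-proper (here _) = refl
    proper-xor-invariant {c} {c′} c-proper c′-proper (step {u = x} {v = w} x∈X xw rest) =
      trans across (proper-xor-invariant c-proper c′-proper rest)
      where
      open ≡-Reasoning
      w∈X : w ∈ X
      w∈X = reach-source rest
      across : c x xor c′ x ≡ c w xor c′ w
      across = begin
        c x xor c′ x             ≡⟨ cong₂ _xor_ (¬-not (c-proper x w x∈X w∈X xw))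
                                                (¬-not (c′-proper x w x∈X w∈X xw)) ⟩
        not (c w) xor not (c′ w) ≡⟨ xor-annihilates-not (c w) (c′ w) ⟩
        c w xor c′ w             ∎

    proper-sameColour : ∀ {c c′} → ProperTwoColouring G X c → ProperTwoColouring G X c′ →
                        ∀ {x y} → x ∈ X → y ∈ X → c x ≡ c y → c′ x ≡ c′ y
    proper-sameColour {c} {c′} c-proper c′-proper {x} {y} x∈X y∈X cx≡cy =
      xor-cancelˡ (c y) (trans (cong (_xor c′ x) (sym cx≡cy))
                               (proper-xor-invariant c-proper c′-proper (connected x y x∈X y∈X)))

    module _ {c : V G → Bool} (c-proper : ProperTwoColouring G X c) (split : NeighboursSplit X) where

      monochromatic-stable : ∀ {Y b} → (∀ {y} → y ∈ Y → y ∈ X × c y ≡ b) → Stable G Y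
      monochromatic-stable mono a a′ a∈Y a′∈Y aa′ with mono a∈Y | mono a′∈Y
      ... | a∈X , refl | a′∈X , ca′ = c-proper a a′ a∈X a′∈X aa′ (sym ca′)

      monochromatic-unmixed : ∀ {Y b v} → (∀ {y} → y ∈ Y → y ∈ X × c y ≡ b) → v ∉ X → ¬ Mixed G v Y
      monochromatic-unmixed {v = v} mono v∉X (_ , (a , a∈Y , va) , (a′ , a′∈Y , ¬va′))
        with mono a∈Y | mono a′∈Y
      ... | a∈X , refl | a′∈X , ca′ =
        ¬va′ (adjTo⁻ (trans (sym (proper-sameColour c-proper (split v a v∉X a∈X va) a∈X a′∈X (sym ca′)))
                            (adjTo⁺ va)))

      proper-bothColours : 1 < ∣ X ∣ → (∃[ a ] (a ∈ X × c a ≡ true)) × (∃[ b ] (b ∈ X × c b ≡ false))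
      proper-bothColours 1<∣X∣ with connectedSet-edge connected 1<∣X∣
      ... | x , y , x∈X , y∈X , xy with c x in cx | c y in cy | c-proper x y x∈X y∈X xy
      ... | true  | true  | cx≢cy = contradiction refl cx≢cy
      ... | true  | false | _     = (x , x∈X , cx) , (y , y∈X , cy)
      ... | false | true  | _     = (y , y∈X , cy) , (x , x∈X , cx)
      ... | false | false | cx≢cy = contradiction refl cx≢cy

      colourClasses-homPair : ∀ {p} → p ∉ X → 2 < ∣ X ∣ →
                              NonTrivialHomPairStable G (X ∩ tabulate c) (X ∩ ∁ (tabulate c))
      colourClasses-homPair {p} p∉X 2<∣X∣ with proper-bothColours (<-trans (s<s z<s) 2<∣X∣)
      ... | (a , a∈X , ca) , (b , b∈X , cb) =
        (λ x x∈A x∈B → case trans (sym (proj₂ (x∈p∩tabulate⁻ x∈A))) (proj₂ (x∈p∩∁tabulate⁻ x∈B)) of λ ()) ,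
        (a , x∈p∩tabulate⁺ a∈X ca) , (b , x∈p∩∁tabulate⁺ b∈X cb) ,
        monochromatic-stable x∈p∩tabulate⁻ , monochromatic-stable x∈p∩∁tabulate⁻ ,
        subst (2 <_) (sym ∣A∣+∣B∣≡∣X∣) 2<∣X∣ ,
        subst (_< n) (sym ∣A∣+∣B∣≡∣X∣) ∣X∣<n ,
        λ v v∉A v∉B → let v∉X = λ v∈X → Sum.[ v∉A , v∉B ] (x∈p⇒x∈p∩tabulate⊎x∈p∩∁tabulate c v∈X) in
                      monochromatic-unmixed x∈p∩tabulate⁻ v∉X , monochromatic-unmixed x∈p∩∁tabulate⁻ v∉X
        where
        ∣A∣+∣B∣≡∣X∣ : ∣ X ∩ tabulate c ∣ + ∣ X ∩ ∁ (tabulate c) ∣ ≡ ∣ X ∣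
        ∣A∣+∣B∣≡∣X∣ = ∣p∩q∣+∣p∩∁q∣≡∣p∣ X (tabulate c)

        ∣X∣<n : ∣ X ∣ < n
        ∣X∣<n = subst (∣ X ∣ <_) (∣⊤∣≡n n) (p⊂q⇒∣p∣<∣q∣ ((λ _ → ∈⊤) , p , ∈⊤ , p∉X))

  clean⇒∣X∣≤2 : Clean G → ∀ {X p c} → ConnectedSet X → p ∉ X → ProperTwoColouring G X c →
                NeighboursSplit X → ∣ X ∣ ≤ 2
  clean⇒∣X∣≤2 clean {X} connected p∉X c-proper split with 2 <? ∣ X ∣
  ... | yes 2<∣X∣ = ⊥-elim (proj₂ clean (_ , _ , colourClasses-homPair connected c-proper split p∉X 2<∣X∣))
  ... | no  2≮∣X∣ = ≮⇒≥ 2≮∣X∣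

isS? : (a : Part) → Dec (a ≡ S)
isS? P = no λ ()
isS? Q = no λ ()
isS? R = no λ ()
isS? S = yes refl
isS? T = no λ ()

module Labelled (G : Graph) (lab : V G → Part) where
  open Graph G renaming (sym to adj-sym)
  open GraphProperties G

  RS PQ : V G → Set
  RS x = lab x ≡ R ⊎ lab x ≡ S
  PQ x = lab x ≡ P ⊎ lab x ≡ Q

  RS≢PQ : ∀ {x y} → RS x → PQ y → x ≢ y
  RS≢PQ (inj₁ x∈R) (inj₁ x∈P) refl = case trans (sym x∈R) x∈P of λ ()
  RS≢PQ (inj₁ x∈R) (inj₂ x∈Q) refl = case trans (sym x∈R) x∈Q of λ ()
  RS≢PQ (inj₂ x∈S) (inj₁ x∈P) refl = case trans (sym x∈S) x∈P of λ ()
  RS≢PQ (inj₂ x∈S) (inj₂ x∈Q) refl = case trans (sym x∈S) x∈Q of λ ()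

  P₄ViaP : V G → V G → Set
  P₄ViaP p₁ q = ∃[ p₂ ] ∃[ p₃ ] (lab p₂ ≡ P × lab p₃ ≡ P × IsInducedPath G (lookup (p₁ ∷ p₂ ∷ p₃ ∷ q ∷ [])))

  regroup : ∀ {A : V G → Set} {q} →
            ∃[ p₁ ] ∃[ p₂ ] ∃[ p₃ ] (A p₁ × lab p₂ ≡ P × lab p₃ ≡ P ×
                                     IsInducedPath G (lookup (p₁ ∷ p₂ ∷ p₃ ∷ q ∷ []))) →
            ∃[ p₁ ] (A p₁ × P₄ViaP p₁ q)
  regroup (p₁ , p₂ , p₃ , Ap₁ , path) = p₁ , Ap₁ , p₂ , p₃ , path

  module Setting
    (clean : Clean G) (connected : Connected G) (P₇-free : P7Free G) (triangleFree : TriangleFree G)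
    (PT-RS : ∀ u v → (lab u ≡ P ⊎ lab u ≡ T) → (lab v ≡ R ⊎ lab v ≡ S) → ¬ Adj u v)
    (S-PQ : ∀ u v → lab u ≡ S → (lab v ≡ P ⊎ lab v ≡ Q) → ¬ Adj u v)
    (R-Q : ∀ r → lab r ≡ R → ∃[ q ] (lab q ≡ Q × Adj r q))
    (q₀ : V G) (q₀∈Q : lab q₀ ≡ Q) (p₀ : V G) (p₀∈P : lab p₀ ≡ P) (p₀-leg : P₄ViaP p₀ q₀)
    (Q-legs : ∀ q → lab q ≡ Q → ∃[ p ] ((lab p ≡ P ⊎ p ≡ q₀) × P₄ViaP p q))
    where

    P-far : ∀ {p x} → lab p ≡ P → RS x → ¬ Adj p x
    P-far p∈P = PT-RS _ _ (inj₁ p∈P)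

    RS-apart-P : ∀ {x p} → RS x → lab p ≡ P → Apart x p
    RS-apart-P x∈RS p∈P = RS≢PQ x∈RS (inj₁ p∈P) , λ xp → P-far p∈P x∈RS (adj-sym xp)

    -- u–w–z–q–p₃–p₂–p would be an induced P₇.
    noRSPathBeforeP₄ : ∀ {u w z q p} → RS u → RS w → RS z → Adj u w → Adj w z → u ≢ z →
                       lab q ≡ Q → Adj z q → ¬ Adj u q →
                       PQ p → ¬ Adj p u → ¬ Adj p w → ¬ Adj p z → P₄ViaP p q → ⊥
    noRSPathBeforeP₄ {u} {w} {z} {q} {p} u∈RS w∈RS z∈RS uw wz u≢z q∈Q zq ¬uq p∈PQ ¬pu ¬pw ¬pz
                     (p₂ , p₃ , p₂∈P , p₃∈P , leg) =
      P₇-free (_ , inducedPath-∷ uw ((u≢z , λ uz → triangleFree u w z uw wz uz) ∷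
                                     (RS≢PQ u∈RS (inj₂ q∈Q) , ¬uq) ∷ apart-leg u∈RS ¬pu)
                   (inducedPath-∷ wz ((RS≢PQ w∈RS (inj₂ q∈Q) , λ wq → triangleFree w z q wz zq wq) ∷
                                      apart-leg w∈RS ¬pw)
                   (inducedPath-∷ zq (apart-leg z∈RS ¬pz) (inducedP₄-reverse leg))))
      where
      apart-leg : ∀ {x} → RS x → ¬ Adj p x → All (Apart x) (p₃ ∷ p₂ ∷ p ∷ [])
      apart-leg x∈RS ¬px = RS-apart-P x∈RS p₃∈P ∷ RS-apart-P x∈RS p₂∈P ∷
                           (RS≢PQ x∈RS p∈PQ , λ xp → ¬px (adj-sym xp)) ∷ []

    noRSPathBeforeP₄ᴾ : ∀ {u w z q p} → RS u → RS w → RS z → Adj u w → Adj w z → u ≢ z →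
                        lab q ≡ Q → Adj z q → ¬ Adj u q → lab p ≡ P → P₄ViaP p q → ⊥
    noRSPathBeforeP₄ᴾ u∈RS w∈RS z∈RS uw wz u≢z q∈Q zq ¬uq p∈P =
      noRSPathBeforeP₄ u∈RS w∈RS z∈RS uw wz u≢z q∈Q zq ¬uq (inj₁ p∈P)
                       (P-far p∈P u∈RS) (P-far p∈P w∈RS) (P-far p∈P z∈RS)

    S-neighbour-RS : ∀ {s y} → lab s ≡ S → Adj s y → RS y
    S-neighbour-RS {s} {y} s∈S sy with lab y in y∈
    ... | P = ⊥-elim (S-PQ s y s∈S (inj₁ y∈) sy)
    ... | Q = ⊥-elim (S-PQ s y s∈S (inj₂ y∈) sy)
    ... | R = inj₁ refl
    ... | S = inj₂ refl
    ... | T = ⊥-elim (PT-RS y s (inj₂ y∈) (inj₂ s∈S) (adj-sym sy))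

    S-undominated-by-Q : ∀ {s q} → lab s ≡ S → lab q ≡ Q → ∃[ y ] (Adj s y × ¬ Adj q y)
    S-undominated-by-Q s∈S q∈Q =
      undominated-witness (proj₁ clean) (RS≢PQ (inj₂ s∈S) (inj₂ q∈Q)) (S-PQ _ _ s∈S (inj₂ q∈Q))

    S-R-nonadjacent : ∀ {s r} → lab s ≡ S → lab r ≡ R → ¬ Adj s r
    S-R-nonadjacent {s} {r} s∈S r∈R sr with dec r q₀
    ... | yes rq₀ with S-undominated-by-Q s∈S q₀∈Q
    ...   | y , sy , ¬q₀y =
      noRSPathBeforeP₄ᴾ (S-neighbour-RS s∈S sy) (inj₂ s∈S) (inj₁ r∈R) (adj-sym sy) sr
                        (≢-by-adjacency ¬q₀y (adj-sym rq₀)) q₀∈Q rq₀ (¬q₀y ∘ adj-sym) p₀∈P p₀-leg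
    S-R-nonadjacent {s} {r} s∈S r∈R sr | no ¬rq₀ with R-Q r r∈R
    ... | q , q∈Q , rq with S-undominated-by-Q s∈S q∈Q | Q-legs q q∈Q
    ...   | y , sy , ¬qy | p , inj₁ p∈P , leg =
      noRSPathBeforeP₄ᴾ (S-neighbour-RS s∈S sy) (inj₂ s∈S) (inj₁ r∈R) (adj-sym sy) sr
                        (≢-by-adjacency ¬qy (adj-sym rq)) q∈Q rq (¬qy ∘ adj-sym) p∈P leg
    ...   | y , sy , ¬qy | _ , inj₂ refl , leg with dec q₀ y
    ...     | no ¬q₀y =
      noRSPathBeforeP₄ (S-neighbour-RS s∈S sy) (inj₂ s∈S) (inj₁ r∈R) (adj-sym sy) sr
                       (≢-by-adjacency ¬qy (adj-sym rq)) q∈Q rq (¬qy ∘ adj-sym)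
                       (inj₂ q₀∈Q) ¬q₀y (S-PQ s q₀ s∈S (inj₂ q₀∈Q) ∘ adj-sym) (¬rq₀ ∘ adj-sym) leg
    ...     | yes q₀y =
      -- q₀ sees y, so the path r–s–y, ending at q₀, is used together with the leg of q₀
      noRSPathBeforeP₄ᴾ (inj₁ r∈R) (inj₂ s∈S) (S-neighbour-RS s∈S sy) (adj-sym sr) sy
                        (≢-by-adjacency ¬qy (adj-sym rq) ∘ sym) q₀∈Q (adj-sym q₀y) ¬rq₀ p₀∈P p₀-leg

    S-empty : ∀ v → lab v ≢ S
    S-empty v v∈S
      with reach-exit (isS? ∘ lab) (connected v p₀) v∈S (λ p₀∈S → case trans (sym p₀∈P) p₀∈S of λ ())
    ... | s , r , s∈S , r∉S , sr with S-neighbour-RS s∈S sr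
    ...   | inj₁ r∈R = S-R-nonadjacent s∈S r∈R sr
    ...   | inj₂ r∈S = r∉S r∈S

    module Component (X : Subset n) (component : IsComponentOf G (λ v → lab v ≡ R) X) where

      X⊆R : ∀ {x} → x ∈ X → lab x ≡ R
      X⊆R = proj₁ (proj₂ component) _

      X-connected : ConnectedSet X
      X-connected = proj₁ (proj₂ (proj₂ component))

      outside-neighbour-Q : ∀ {v x} → v ∉ X → x ∈ X → Adj v x → lab v ≡ Q
      outside-neighbour-Q {v} {x} v∉X x∈X vx with lab v in v∈
      ... | P = ⊥-elim (PT-RS v x (inj₁ v∈) (inj₁ (X⊆R x∈X)) vx)
      ... | Q = refl
      ... | R = ⊥-elim (v∉X (proj₂ (proj₂ (proj₂ component)) x v x∈X v∈ (adj-sym vx)))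
      ... | S = ⊥-elim (S-empty v v∈)
      ... | T = ⊥-elim (PT-RS v x (inj₂ v∈) (inj₁ (X⊆R x∈X)) vx)

      leg⇒dist2Closed : ∀ {q p} → lab q ≡ Q → PQ p → (∀ {x} → x ∈ X → ¬ Adj p x) → P₄ViaP p q →
                        Dist2Closed q X
      leg⇒dist2Closed {q} q∈Q p∈PQ p≁X leg {u} u∈X w∈X z∈X uw wz u≢z qz with dec q u
      ... | yes qu = qu
      ... | no ¬qu = ⊥-elim (noRSPathBeforeP₄ (inj₁ (X⊆R u∈X)) (inj₁ (X⊆R w∈X)) (inj₁ (X⊆R z∈X))
                                              uw wz u≢z q∈Q (adj-sym qz) (¬qu ∘ adj-sym)
                                              p∈PQ (p≁X u∈X) (p≁X w∈X) (p≁X z∈X) leg)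

      P-leg⇒dist2Closed : ∀ {q p} → lab q ≡ Q → lab p ≡ P → P₄ViaP p q → Dist2Closed q X
      P-leg⇒dist2Closed q∈Q p∈P = leg⇒dist2Closed q∈Q (inj₁ p∈P) (λ x∈X → P-far p∈P (inj₁ (X⊆R x∈X)))

      dist2Closed⇒proper : ∀ {q x} → Dist2Closed q X → x ∈ X → Adj q x → ProperTwoColouring G X (adjTo q)
      dist2Closed⇒proper closed x∈X qx =
        covers⇒proper triangleFree (dist2Closed⇒covers closed X-connected x∈X qx)

      module _ (Q-closed : ∀ q → lab q ≡ Q → Dist2Closed q X) where

        colouring : ∃[ q ] ProperTwoColouring G X (adjTo q)
        colouring with proj₁ component
        ... | x , x∈X with R-Q x (X⊆R x∈X)
        ...   | q , q∈Q , xq = q , dist2Closed⇒proper (Q-closed q q∈Q) x∈X (adj-sym xq)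

        ∣X∣≤2 : ∣ X ∣ ≤ 2
        ∣X∣≤2 = clean⇒∣X∣≤2 clean X-connected p₀∉X (proj₂ colouring) split
          where
          p₀∉X : p₀ ∉ X
          p₀∉X p₀∈X = case trans (sym p₀∈P) (X⊆R p₀∈X) of λ ()
          split : NeighboursSplit X
          split v x v∉X x∈X vx = dist2Closed⇒proper (Q-closed v (outside-neighbour-Q v∉X x∈X vx)) x∈X vx

      bipartite-with-q₀-side : Bipartite G X × (2 < ∣ X ∣ → ∃[ c ] ∃[ b ] (ProperTwoColouring G X c ×
                                                CompleteTo G q₀ (λ x → x ∈ X × c x ≡ b)))
      bipartite-with-q₀-side with any? (λ x → x ∈? X ×-dec dec q₀ x)
      ... | yes (x , x∈X , q₀x) = (adjTo q₀ , proper) , λ _ → adjTo q₀ , true , proper , λ _ → adjTo⁻ ∘ proj₂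
        where
        proper : ProperTwoColouring G X (adjTo q₀)
        proper = dist2Closed⇒proper (P-leg⇒dist2Closed q₀∈Q p₀∈P p₀-leg) x∈X q₀x
      ... | no q₀≁X = (_ , proj₂ (colouring Q-closed)) , λ 2<∣X∣ → contradiction (∣X∣≤2 Q-closed) (<⇒≱ 2<∣X∣)
        where
        Q-closed : ∀ q → lab q ≡ Q → Dist2Closed q X
        Q-closed q q∈Q with Q-legs q q∈Q
        ... | p , inj₁ p∈P , leg = P-leg⇒dist2Closed q∈Q p∈P leg
        ... | _ , inj₂ refl , leg = leg⇒dist2Closed q∈Q (inj₂ q₀∈Q) (λ x∈X q₀x → q₀≁X (_ , x∈X , q₀x)) leg

mainTheorem8 : (G : Graph) → let open Graph G in
  (lab : Fin n → Part) →
  Clean G → Connected G → P7Free G → TriangleFree G →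
  (∀ u v → (lab u ≡ P ⊎ lab u ≡ T) → (lab v ≡ R ⊎ lab v ≡ S) → ¬ Adj u v) →
  (∀ u v → lab u ≡ S → (lab v ≡ P ⊎ lab v ≡ Q) → ¬ Adj u v) →
  (∀ r → lab r ≡ R → ∃[ q ] (lab q ≡ Q × Adj r q)) →
  (q₀ : Fin n) → lab q₀ ≡ Q →
  (∃[ p₁ ] ∃[ p₂ ] ∃[ p₃ ] (lab p₁ ≡ P × lab p₂ ≡ P × lab p₃ ≡ P ×
      IsInducedPath G (lookup (p₁ ∷ p₂ ∷ p₃ ∷ q₀ ∷ [])))) →
  (∀ q → lab q ≡ Q → ∃[ p₁ ] ∃[ p₂ ] ∃[ p₃ ] ((lab p₁ ≡ P ⊎ p₁ ≡ q₀) × lab p₂ ≡ P × lab p₃ ≡ P ×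
      IsInducedPath G (lookup (p₁ ∷ p₂ ∷ p₃ ∷ q ∷ [])))) →
  ((∀ v → lab v ≢ S) ×
   ((∀ q → lab q ≡ Q → ∃[ p₁ ] ∃[ p₂ ] ∃[ p₃ ] (lab p₁ ≡ P × lab p₂ ≡ P × lab p₃ ≡ P ×
       IsInducedPath G (lookup (p₁ ∷ p₂ ∷ p₃ ∷ q ∷ [])))) →
     ∀ (X : Subset n) → IsComponentOf G (λ v → lab v ≡ R) X → ∣ X ∣ ≤ 2) ×
   (∀ (X : Subset n) → IsComponentOf G (λ v → lab v ≡ R) X →
     Bipartite G X ×
     (2 < ∣ X ∣ → ∃[ c ] ∃[ b ] (ProperTwoColouring G X c ×
        CompleteTo G q₀ (λ x → x ∈ X × c x ≡ b)))))
mainTheorem8 G lab clean connected P₇-free triangleFree PT-RS S-PQ R-Q q₀ q₀∈Q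
             (p₀ , p₂ , p₃ , p₀∈P , p₂∈P , p₃∈P , q₀-path) Q-paths =
  S-empty ,
  (λ P-paths X component → Component.∣X∣≤2 X component
                             (λ q q∈Q → let p , p∈P , leg = regroup (P-paths q q∈Q) in
                                        Component.P-leg⇒dist2Closed X component q∈Q p∈P leg)) ,
  (λ X component → Component.bipartite-with-q₀-side X component)
  where
  open Labelled G lab
  open Setting clean connected P₇-free triangleFree PT-RS S-PQ R-Q q₀ q₀∈Q
               p₀ p₀∈P (p₂ , p₃ , p₂∈P , p₃∈P , q₀-path) (λ q q∈Q → regroup (Q-paths q q∈Q))
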